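{- Let $m,q,k\ge 1$, $y\in\Omega^k$, and let $r$ be a positive divisor of $m$. Define $\mathcal{LC}_y(m,r;q,k)=\{t^{m/r}: t\in\mathcal{LC}_y(r,q,k)\}$. Then $$\mathcal{LC}_y(m,r;q,k)=\bigcup_{d:\ d\mid m \text{ and } (m/r)\mid d}\mathcal{LC}^{(d)}_y(m,q,k).$$
   Context: Let $\Omega$ be a totally ordered alphabet of size $q\ge 1$; a $k$-mer is an element of $\Omega^k$. For a linear sequence $t$, $t^i$ denotes the concatenation of $i$ copies of $t$. For $s=a_1\ldots a_n$ define $\rho(a_1\ldots a_n)=a_na_1\ldots a_{n-1}$; the cyclic sequence $(s)$ is the set of rotations $\{\rho^i(s)\}$, each a linearization of $(s)$. The number of occurrences of a $k$-mer $y$ in $(a_1\ldots a_n)$ is the number of $i\in\{1,\ldots,n\}$ with $a_i\cdots a_{i+k-1}=y$, indices modulo $n$ (positions may be reused if $k>n$). A cyclic multi de Bruijn sequence with parameters $(m,q,k)$ is a cyclic sequence over $\Omega$ in which every $k$-mer occurs exactly $m$ times. $\mathcal{LC}_y(m,q,k)$ is the set of linearizations of such sequences that start with the $k$-mer $y$. The order of a linearization $s$ of length $n$ is the largest positive divisor $d$ of $n$ with $\rho^{n/d}(s)=s$; $\mathcal{LC}^{(d)}_y(m,q,k)$ is the subset of $\mathcal{LC}_y(m,q,k)$ of elements of order $d$. -}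

module Defs where

open import Data.Nat using (ℕ; zero; suc; _+_; _*_; _≤_; _<_; _/_; _%_; NonZero)
open import Data.Nat.Divisibility using (_∣_)
open import Data.Fin using (Fin; fromℕ<)
open import Data.Nat.DivMod using (m%n<n)
open import Data.List using (List; []; _∷_; length; lookup; concat; replicate; _++_; filterᵇ; upTo; initLast; _∷ʳ_)
import Data.List as L
open import Data.Vec using (Vec; tabulate)
open import Data.Product using (Σ; ∃; _×_)
open import Data.Bool using (Bool)
open import Function using (_⇔_)
open import Relation.Binary.PropositionalEquality using (_≡_)
open import Relation.Nullary.Decidable using (⌊_⌋)
open import Data.Vec.Properties using () renaming (≡-dec to vec-≡-dec)
open import Data.Fin.Properties using () renaming (_≟_ to _≟ᶠ_)

-- The alphabet Ω of size q is Fin q (totally ordered by the usual order).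
-- Linear sequences are lists; k-mers are vectors of length k.

ρ : {A : Set} → List A → List A
ρ xs with initLast xs
... | [] = []
... | ys L.∷ʳ′ y = y ∷ ys

ρ^ : {A : Set} → ℕ → List A → List A
ρ^ zero xs = xs
ρ^ (suc i) xs = ρ (ρ^ i xs)

-- the k-mer a_{i+1} … a_{i+k} of the cyclic sequence (s) (0-based start i),
-- indices taken modulo n = length s; only meaningful for nonempty s
window : {A : Set} (s : List A) → .{{NonZero (length s)}} → ℕ → (k : ℕ) → Vec A k
window s i k = tabulate (λ j → lookup s (fromℕ< (m%n<n (i + Data.Fin.toℕ j) (length s))))

occ : {q k : ℕ} → List (Fin q) → Vec (Fin q) k → ℕ
occ [] y = 0
occ {q} {k} s@(_ ∷ _) y =
  length (filterᵇ (λ i → ⌊ vec-≡-dec _≟ᶠ_ (window s i k) y ⌋) (upTo (length s)))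

IsMultiDeBruijn : (m q k : ℕ) → List (Fin q) → Set
IsMultiDeBruijn m q k s = (x : Vec (Fin q) k) → occ s x ≡ m

-- s starts with the k-mer y (read cyclically, as s is a linearization of a cyclic sequence)
StartsWith : {q k : ℕ} → List (Fin q) → Vec (Fin q) k → Set
StartsWith [] y = Data.Empty.⊥ where import Data.Empty
StartsWith {q} {k} s@(_ ∷ _) y = window s 0 k ≡ y

LC : (m q k : ℕ) → Vec (Fin q) k → List (Fin q) → Set
LC m q k y s = IsMultiDeBruijn m q k s × StartsWith s y

HasOrder : {A : Set} → List A → ℕ → Set
HasOrder s d =
  Σ (NonZero d) λ nz →
    (d ∣ length s) × (ρ^ ((length s / d) {{nz}}) s ≡ s) ×
    ((d' : ℕ) (nz' : NonZero d') → d' ∣ length s →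
       ρ^ ((length s / d') {{nz'}}) s ≡ s → d' ≤ d)

LCd : (d m q k : ℕ) → Vec (Fin q) k → List (Fin q) → Set
LCd d m q k y s = LC m q k y s × HasOrder s d

LCpow : (m r : ℕ) → .{{NonZero r}} → (q k : ℕ) → Vec (Fin q) k → List (Fin q) → Set
LCpow m r q k y s = ∃ λ t → LC r q k y t × s ≡ concat (replicate (m / r) t)

module Submission where

-- The proof reads every linear sequence s through its periodic extension
--   ext s : ℕ → Maybe A,   ext s i = s[i mod |s|],
-- which is how the cyclic sequence (s) is seen by windows, by rotations and by
-- powers:
--   * rotating by j shifts the extension by j, so ρ^j s = s iff j is a period
--     of ext s;
--   * the periods of ext s are exactly the multiples of a fundamental period p₀,
--     and consequently s has order d iff d · p₀ = |s|;
--   * t^c has the same extension as t, and conversely s = (take L s)^c whenever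
--     L is a period with |s| = c · L;
--   * k-mer counts only depend on the extension and scale by c when the length
--     is multiplied by c (they are counts of a periodic Boolean predicate).
-- With c = m / r, the theorem follows: if s = t^c with t ∈ LC_y(r,q,k) and |t| = e·p₀,
-- then s ∈ LC^{(c·e)}_y(m,q,k) and e ∣ r because r = e · (count over one period);
-- conversely, if s ∈ LC^{(d)}_y(m,q,k) with d = e·c, then s = t^c for
-- t = take (e·p₀) s, and t ∈ LC_y(r,q,k) after cancelling c in the counts.

open import Defs
open import Data.Nat using (ℕ; zero; suc; _+_; _*_; _∸_; _≤_; _<_; _≥_; _/_; _%_; NonZero; >-nonZero; >-nonZero⁻¹; s≤s; z≤n)
open import Data.Nat.Properties
open import Data.Nat.DivMod
open import Data.Nat.Divisibility using (_∣_; divides; ∣⇒≤; m%n≡0⇒n∣m; n∣m*n; m∣m*n; *-monoʳ-∣; quotient≢0; n/m≡quotient)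
open import Data.Nat.Induction using (<-rec)
open import Data.Bool using (Bool; true; false)
open import Data.Fin using (Fin; fromℕ<; toℕ)
import Data.Fin as Fin
open import Data.Fin.Properties using () renaming (_≟_ to _≟ᶠ_)
open import Data.Vec using (Vec)
import Data.Vec as Vec
open import Data.Vec.Properties using (tabulate-cong) renaming (≡-dec to ≡-decᵛ)
open import Data.List using (List; []; _∷_; length; lookup; concat; replicate; _++_; take; filterᵇ; applyUpTo; initLast)
import Data.List as L
open import Data.List.Properties using (length-++; length-take)
open import Data.Maybe using (Maybe; just; nothing)
open import Data.Maybe.Properties using (just-injective) renaming (≡-dec to ≡-decᵐ)
open import Data.Empty using (⊥-elim)
open import Data.Product using (Σ; ∃; _×_; _,_)
open import Data.Sum using (inj₁; inj₂)
open import Function using (_⇔_; mk⇔; Equivalence; it)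
open import Relation.Binary.Definitions using (DecidableEquality)
open import Relation.Binary.PropositionalEquality
open import Relation.Nullary using (Dec; yes; no; ¬_)
open import Relation.Nullary.Decidable using (⌊_⌋; map′; _×-dec_)
open import Relation.Unary using (Decidable)

module _ {A : Set} where

  at : List A → ℕ → Maybe A
  at []       _       = nothing
  at (x ∷ xs) zero    = just x
  at (x ∷ xs) (suc i) = at xs i

  ext : List A → ℕ → Maybe A
  ext []         _ = nothing
  ext s@(_ ∷ _) i = at s (i % length s)

  at-lookup : (s : List A) (i : ℕ) (i<n : i < length s) → at s i ≡ just (lookup s (fromℕ< i<n))
  at-lookup (x ∷ xs) zero    _         = refl
  at-lookup (x ∷ xs) (suc i) (s≤s i<n) = at-lookup xs i i<n

  at-beyond : (s : List A) (i : ℕ) → length s ≤ i → at s i ≡ nothing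
  at-beyond []       i       _         = refl
  at-beyond (x ∷ xs) (suc i) (s≤s n≤i) = at-beyond xs i n≤i

  at-++ˡ : (xs ys : List A) (i : ℕ) → i < length xs → at (xs ++ ys) i ≡ at xs i
  at-++ˡ (x ∷ xs) ys zero    _         = refl
  at-++ˡ (x ∷ xs) ys (suc i) (s≤s i<n) = at-++ˡ xs ys i i<n

  at-++ʳ : (xs ys : List A) (j : ℕ) → at (xs ++ ys) (length xs + j) ≡ at ys j
  at-++ʳ []       ys j = refl
  at-++ʳ (x ∷ xs) ys j = at-++ʳ xs ys j

  at-take : (L : ℕ) (s : List A) (j : ℕ) → j < L → at (take L s) j ≡ at s j
  at-take (suc L) []       j       _         = refl
  at-take (suc L) (x ∷ xs) zero    _         = refl
  at-take (suc L) (x ∷ xs) (suc j) (s≤s j<L) = at-take L xs j j<L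

  at-injective : (xs ys : List A) → (∀ i → at xs i ≡ at ys i) → xs ≡ ys
  at-injective []       []       _ = refl
  at-injective []       (y ∷ ys) h with h 0
  ... | ()
  at-injective (x ∷ xs) []       h with h 0
  ... | ()
  at-injective (x ∷ xs) (y ∷ ys) h =
    cong₂ _∷_ (just-injective (h 0)) (at-injective xs ys (λ i → h (suc i)))

  ext-via-length : (s : List A) {n : ℕ} → length s ≡ suc n → ∀ i → ext s i ≡ at s (i % suc n)
  ext-via-length (x ∷ xs) eq i = cong (λ l → at (x ∷ xs) (i % suc l)) (suc-injective eq)

  ext-below : (s : List A) (i : ℕ) → i < length s → ext s i ≡ at s i
  ext-below (x ∷ xs) i i<n = cong (at (x ∷ xs)) (m<n⇒m%n≡m i<n)

  ext-shift : (s : List A) (i a : ℕ) → ext s (i + a * length s) ≡ ext s i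
  ext-shift []       i a = refl
  ext-shift (x ∷ xs) i a = cong (at (x ∷ xs)) ([m+kn]%n≡m%n i a (suc (length xs)))

  ext-injective : (xs ys : List A) → length xs ≡ length ys → (∀ i → ext xs i ≡ ext ys i) → xs ≡ ys
  ext-injective xs ys len h = at-injective xs ys same-entries
    where
    same-entries : ∀ i → at xs i ≡ at ys i
    same-entries i with i <? length xs
    ... | yes i<n = trans (sym (ext-below xs i i<n)) (trans (h i) (ext-below ys i (subst (i <_) len i<n)))
    ... | no  i≮n = trans (at-beyond xs i (≮⇒≥ i≮n)) (sym (at-beyond ys i (subst (_≤ i) len (≮⇒≥ i≮n))))

  window-ext : ∀ {k} (s t : List A) .{{_ : NonZero (length s)}} .{{_ : NonZero (length t)}} (i i′ : ℕ) →
               (∀ j → ext s (i + j) ≡ ext t (i′ + j)) → window s i k ≡ window t i′ k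
  window-ext s@(_ ∷ _) t@(_ ∷ _) i i′ h = tabulate-cong λ j →
    just-injective (begin
      just _                               ≡⟨ at-lookup s _ (m%n<n (i + toℕ j) (length s)) ⟨
      ext s (i + toℕ j)                    ≡⟨ h (toℕ j) ⟩
      ext t (i′ + toℕ j)                   ≡⟨ at-lookup t _ (m%n<n (i′ + toℕ j) (length t)) ⟩
      just _                               ∎)
    where open ≡-Reasoning

least-witness : {P : ℕ → Set} → Decidable P → ∀ {n} → P n → ∃ λ p → P p × (∀ {j} → j < p → ¬ P j)
least-witness {P} P? {n} = <-rec (λ n → P n → ∃ λ p → P p × (∀ {j} → j < p → ¬ P j)) descend n
  where
  descend : ∀ n → (∀ {j} → j < n → P j → ∃ λ p → P p × (∀ {i} → i < p → ¬ P i)) →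
            P n → ∃ λ p → P p × (∀ {j} → j < p → ¬ P j)
  descend n below Pn with anyUpTo? P? n
  ... | yes (j , j<n , Pj) = below j<n Pj
  ... | no  none           = n , Pn , λ j<n Pj → none (_ , j<n , Pj)

module _ {B : Set} where

  Periodic : (ℕ → B) → ℕ → Set
  Periodic g p = ∀ i → g (i + p) ≡ g i

  periodic-cong : {g h : ℕ → B} → (∀ i → g i ≡ h i) → ∀ {p} → Periodic g p → Periodic h p
  periodic-cong g≗h {p} per i = trans (sym (g≗h (i + p))) (trans (per i) (g≗h i))

  periodic-* : (g : ℕ → B) {p : ℕ} → Periodic g p → ∀ c → Periodic g (c * p)
  periodic-* g per zero    i = cong g (+-identityʳ i)
  periodic-* g {p} per (suc c) i = begin
    g (i + (p + c * p)) ≡⟨ cong g (trans (cong (i +_) (+-comm p (c * p))) (sym (+-assoc i (c * p) p))) ⟩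
    g (i + c * p + p)   ≡⟨ per (i + c * p) ⟩
    g (i + c * p)       ≡⟨ periodic-* g per c i ⟩
    g i                 ∎
    where open ≡-Reasoning

  periodic-∸ : (g : ℕ → B) (a b : ℕ) → Periodic g (a + b) → Periodic g b → Periodic g a
  periodic-∸ g a b perab perb i = trans (sym (perb (i + a))) (trans (cong g (+-assoc i a b)) (perab i))

  periodic-from-prefix : (g : ℕ → B) (N : ℕ) .{{_ : NonZero N}} → Periodic g N → (p : ℕ) →
                         (∀ {i} → i < N → g (i + p) ≡ g i) → Periodic g p
  periodic-from-prefix g N perN p prefix i = begin
      g (i + p)             ≡⟨ cong (λ j → g (j + p)) split ⟩
      g (r + a * N + p)     ≡⟨ cong g (trans (+-assoc r (a * N) p) (trans (cong (r +_) (+-comm (a * N) p)) (sym (+-assoc r p (a * N))))) ⟩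
      g (r + p + a * N)     ≡⟨ periodic-* g perN a (r + p) ⟩
      g (r + p)             ≡⟨ prefix (m%n<n i N) ⟩
      g r                   ≡⟨ periodic-* g perN a r ⟨
      g (r + a * N)         ≡⟨ cong g split ⟨
      g i                   ∎
    where
    open ≡-Reasoning
    r = i % N
    a = i / N
    split : i ≡ r + a * N
    split = m≡m%n+[m/n]*n i N

  periodic? : DecidableEquality B → (g : ℕ → B) (N : ℕ) .{{_ : NonZero N}} → Periodic g N → ∀ p → Dec (Periodic g p)
  periodic? _≟_ g N perN p =
    map′ (periodic-from-prefix g N perN p) (λ per {i} _ → per i) (allUpTo? (λ i → g (i + p) ≟ g i) N)

  IsFundamentalPeriod : (ℕ → B) → ℕ → Set
  IsFundamentalPeriod g p₀ = NonZero p₀ × Periodic g p₀ × (∀ p → Periodic g p → p₀ ∣ p)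

  -- A sequence with a positive period and decidable entries has a fundamental period:
  -- the least positive period divides every period, by Euclidean division.
  fundamental-period : DecidableEquality B → (g : ℕ → B) (N : ℕ) .{{_ : NonZero N}} → Periodic g N →
                       ∃ (IsFundamentalPeriod g)
  fundamental-period _≟_ g N perN
    with least-witness (λ p → (0 <? p) ×-dec periodic? _≟_ g N perN p) (>-nonZero⁻¹ N , perN)
  ... | p₀ , (p₀>0 , per₀) , none-below = p₀ , nz , per₀ , divides-periods
    where
    nz : NonZero p₀
    nz = >-nonZero p₀>0
    instance _ = nz
    divides-periods : ∀ p → Periodic g p → p₀ ∣ p
    divides-periods p per with p % p₀ in rem
    ... | zero  = m%n≡0⇒n∣m p p₀ rem
    ... | suc j = ⊥-elim (none-below (subst (_< p₀) rem (m%n<n p p₀)) (s≤s z≤n , remainder-periodic))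
      where
      remainder-periodic : Periodic g (suc j)
      remainder-periodic = subst (Periodic g) rem
        (periodic-∸ g (p % p₀) (p / p₀ * p₀)
          (subst (Periodic g) (m≡m%n+[m/n]*n p p₀) per) (periodic-* g per₀ (p / p₀)))

module _ {A : Set} where

  length-period : (s : List A) → Periodic (ext s) (length s)
  length-period s i = trans (cong (λ j → ext s (i + j)) (sym (*-identityˡ (length s)))) (ext-shift s i 1)

  length-∷ʳ : (ys : List A) (y : A) → length (ys ++ y ∷ []) ≡ suc (length ys)
  length-∷ʳ ys y = trans (length-++ ys) (+-comm (length ys) 1)

  length-ρ : (s : List A) → length (ρ s) ≡ length s
  length-ρ s with initLast s
  ... | []          = refl
  ... | ys L.∷ʳ′ y = sym (length-∷ʳ ys y)

  length-ρ^ : (j : ℕ) (s : List A) → length (ρ^ j s) ≡ length s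
  length-ρ^ zero    s = refl
  length-ρ^ (suc j) s = trans (length-ρ (ρ^ j s)) (length-ρ^ j s)

  ρ^-[] : (j : ℕ) → ρ^ j ([] {A = A}) ≡ []
  ρ^-[] zero    = refl
  ρ^-[] (suc j) = cong ρ (ρ^-[] j)

  at-rotate : (ys : List A) (y : A) (j : ℕ) → j ≤ length ys →
              at (y ∷ ys) (suc j % suc (length ys)) ≡ at (ys ++ y ∷ []) j
  at-rotate ys y j j≤n with m≤n⇒m<n∨m≡n j≤n
  ... | inj₁ j<n  = trans (cong (at (y ∷ ys)) (m<n⇒m%n≡m (s≤s j<n))) (sym (at-++ˡ ys (y ∷ []) j j<n))
  ... | inj₂ refl = begin
    at (y ∷ ys) (suc j % suc j)    ≡⟨ cong (at (y ∷ ys)) (n%n≡0 (suc j)) ⟩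
    just y                          ≡⟨ at-++ʳ ys (y ∷ []) 0 ⟨
    at (ys ++ y ∷ []) (j + 0)       ≡⟨ cong (at (ys ++ y ∷ [])) (+-identityʳ j) ⟩
    at (ys ++ y ∷ []) j             ∎
    where open ≡-Reasoning

  ext-ρ : (u : List A) (i : ℕ) → ext (ρ u) (suc i) ≡ ext u i
  ext-ρ u i with initLast u
  ... | []          = refl
  ... | ys L.∷ʳ′ y = begin
    at (y ∷ ys) (suc i % N)            ≡⟨ cong (λ z → at (y ∷ ys) (suc z % N)) (m≡m%n+[m/n]*n i N) ⟩
    at (y ∷ ys) ((suc (i % N) + i / N * N) % N) ≡⟨ cong (at (y ∷ ys)) ([m+kn]%n≡m%n (suc (i % N)) (i / N) N) ⟩
    at (y ∷ ys) (suc (i % N) % N)      ≡⟨ at-rotate ys y (i % N) (≤-pred (m%n<n i N)) ⟩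
    at (ys ++ y ∷ []) (i % N)          ≡⟨ ext-via-length (ys ++ y ∷ []) (length-∷ʳ ys y) i ⟨
    ext (ys ++ y ∷ []) i               ∎
    where
    open ≡-Reasoning
    N = suc (length ys)

  ext-ρ^ : (j : ℕ) (s : List A) (i : ℕ) → ext (ρ^ j s) (i + j) ≡ ext s i
  ext-ρ^ zero    s i = cong (ext s) (+-identityʳ i)
  ext-ρ^ (suc j) s i = trans (cong (ext (ρ^ (suc j) s)) (+-suc i j)) (trans (ext-ρ (ρ^ j s) (i + j)) (ext-ρ^ j s i))

  ρ^-fixed⇒periodic : (j : ℕ) (s : List A) → ρ^ j s ≡ s → Periodic (ext s) j
  ρ^-fixed⇒periodic j s fixed i = trans (cong (λ u → ext u (i + j)) (sym fixed)) (ext-ρ^ j s i)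

  periodic⇒ρ^-fixed : (j : ℕ) (s : List A) → Periodic (ext s) j → ρ^ j s ≡ s
  periodic⇒ρ^-fixed j [] _ = ρ^-[] j
  periodic⇒ρ^-fixed j s@(_ ∷ xs) per = ext-injective u s (length-ρ^ j s) same
    where
    u = ρ^ j s
    n = length xs
    -- j·|s| = j·n + j is a period of both extensions; shifting by it undoes the rotation
    regroup : ∀ i → i + j * suc n ≡ i + j * n + j
    regroup i = trans (cong (i +_) (trans (*-suc j n) (+-comm j (j * n)))) (sym (+-assoc i (j * n) j))
    same : ∀ i → ext u i ≡ ext s i
    same i = begin
      ext u i                  ≡⟨ ext-shift u i j ⟨
      ext u (i + j * length u) ≡⟨ cong (λ l → ext u (i + j * l)) (length-ρ^ j s) ⟩
      ext u (i + j * suc n)    ≡⟨ cong (ext u) (regroup i) ⟩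
      ext u (i + j * n + j)    ≡⟨ ext-ρ^ j s (i + j * n) ⟩
      ext s (i + j * n)        ≡⟨ per (i + j * n) ⟨
      ext s (i + j * n + j)    ≡⟨ cong (ext s) (regroup i) ⟨
      ext s (i + j * suc n)    ≡⟨ ext-shift s i j ⟩
      ext s i                  ∎
      where open ≡-Reasoning

module _ {A : Set} where

  pow : ℕ → List A → List A
  pow c t = concat (replicate c t)

  length-pow : (c : ℕ) (t : List A) → length (pow c t) ≡ c * length t
  length-pow zero    t = refl
  length-pow (suc c) t = trans (length-++ t) (cong (length t +_) (length-pow c t))

  at-pow : (t : List A) (c j : ℕ) → j < c * length t → at (pow c t) j ≡ ext t j
  at-pow t (suc c) j j<cn with j <? length t
  ... | yes j<n = trans (at-++ˡ t (pow c t) j j<n) (sym (ext-below t j j<n))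
  ... | no  j≮n = begin
    at (t ++ pow c t) j                ≡⟨ cong (at (t ++ pow c t)) split ⟨
    at (t ++ pow c t) (length t + j′)  ≡⟨ at-++ʳ t (pow c t) j′ ⟩
    at (pow c t) j′                    ≡⟨ at-pow t c j′ j′<cn ⟩
    ext t j′                           ≡⟨ ext-shift t j′ 1 ⟨
    ext t (j′ + 1 * length t)          ≡⟨ cong (ext t) (trans (cong (j′ +_) (*-identityˡ (length t))) (trans (+-comm j′ (length t)) split)) ⟩
    ext t j                            ∎
    where
    open ≡-Reasoning
    j′ = j ∸ length t
    split : length t + j′ ≡ j
    split = m+[n∸m]≡n (≮⇒≥ j≮n)
    j′<cn : j′ < c * length t
    j′<cn = +-cancelˡ-< (length t) j′ (c * length t) (subst (_< length t + c * length t) (sym split) j<cn)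

  ext-pow : (c : ℕ) (x : A) (xs : List A) (i : ℕ) → ext (pow (suc c) (x ∷ xs)) i ≡ ext (x ∷ xs) i
  ext-pow c x xs i = begin
    ext (pow (suc c) t) i   ≡⟨ ext-via-length (pow (suc c) t) (length-pow (suc c) t) i ⟩
    at (pow (suc c) t) (i % M) ≡⟨ at-pow t (suc c) (i % M) (m%n<n i M) ⟩
    at t (i % M % L)        ≡⟨ cong (at t) (m∣n⇒o%n%m≡o%m L M i (n∣m*n (suc c))) ⟩
    at t (i % L)            ∎
    where
    open ≡-Reasoning
    t = x ∷ xs
    L = length t
    M = suc c * L

  power-of-prefix : (s : List A) (c L : ℕ) .{{_ : NonZero L}} → Periodic (ext s) L →
                    length s ≡ suc c * L → s ≡ pow (suc c) (take L s)
  power-of-prefix s@(x ∷ xs) c L@(suc l) perL len =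
    ext-injective s (pow (suc c) t) (trans len (sym lengths)) λ i → sym (trans (ext-pow c x (take l xs) i) (ext-prefix i))
    where
    t = take L s
    L≤n : L ≤ length s
    L≤n = subst (L ≤_) (sym len) (m≤n*m L (suc c))
    length-t : length t ≡ L
    length-t = trans (length-take L s) (m≤n⇒m⊓n≡m L≤n)
    lengths : length (pow (suc c) t) ≡ suc c * L
    lengths = trans (length-pow (suc c) t) (cong (suc c *_) length-t)
    -- both extensions repeat with period L and agree on 0 … L-1
    ext-prefix : ∀ i → ext t i ≡ ext s i
    ext-prefix i = begin
      ext t i                    ≡⟨ cong (ext t) split ⟩
      ext t (r + a * L)          ≡⟨ cong (λ l′ → ext t (r + a * l′)) length-t ⟨
      ext t (r + a * length t)   ≡⟨ ext-shift t r a ⟩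
      ext t r                    ≡⟨ ext-below t r (subst (r <_) (sym length-t) r<L) ⟩
      at t r                     ≡⟨ at-take L s r r<L ⟩
      at s r                     ≡⟨ ext-below s r (≤-trans r<L L≤n) ⟨
      ext s r                    ≡⟨ periodic-* (ext s) perL a r ⟨
      ext s (r + a * L)          ≡⟨ cong (ext s) split ⟨
      ext s i                    ∎
      where
      open ≡-Reasoning
      r = i % L
      a = i / L
      split : i ≡ r + a * L
      split = m≡m%n+[m/n]*n i L
      r<L : r < L
      r<L = m%n<n i L

module Order {A : Set} (s : List A) .{{n≢0 : NonZero (length s)}} {p₀ : ℕ} .{{_ : NonZero p₀}}
             (per₀ : Periodic (ext s) p₀) (divides-periods : ∀ p → Periodic (ext s) p → p₀ ∣ p) where

  private
    n = length s

  Admissible : ℕ → Set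
  Admissible d = Σ (NonZero d) λ nz → d ∣ n × ρ^ ((n / d) {{nz}}) s ≡ s

  -- Every admissible d satisfies d · p₀ ≤ |s|, since p₀ divides the rotation |s| / d.
  admissible-bound : (d : ℕ) → Admissible d → d * p₀ ≤ n
  admissible-bound d (nz , d∣n , fixed) = begin
      d * p₀ ≤⟨ *-monoʳ-≤ d (∣⇒≤ {{a≢0}} (divides-periods a (ρ^-fixed⇒periodic a s fixed))) ⟩
      d * a  ≡⟨ *-comm d a ⟩
      a * d  ≡⟨ m/n*n≡m {{nz}} d∣n ⟩
      n      ∎
    where
    open ≤-Reasoning
    a = (n / d) {{nz}}
    a≢0 : NonZero a
    a≢0 = subst NonZero (sym (n/m≡quotient d∣n {{nz}})) (quotient≢0 d∣n)

  -- A cofactor of p₀ in |s| is admissible, as rotating by p₀ fixes s.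
  cofactor-admissible : (d : ℕ) → d * p₀ ≡ n → Admissible d
  cofactor-admissible d dp₀≡n = d≢0 , divides p₀ n≡p₀d , periodic⇒ρ^-fixed (n / d) s per
    where
    d≢0 : NonZero d
    d≢0 = m*n≢0⇒m≢0 d {{subst NonZero (sym dp₀≡n) n≢0}}
    instance _ = d≢0
    n≡p₀d : n ≡ p₀ * d
    n≡p₀d = trans (sym dp₀≡n) (*-comm d p₀)
    per : Periodic (ext s) (n / d)
    per = subst (Periodic (ext s)) (sym (trans (cong (_/ d) n≡p₀d) (m*n/n≡m p₀ d))) per₀

  -- s has order d exactly when d · p₀ = |s|: a cofactor is admissible and beats every
  -- admissible d′ …
  order-of-cofactor : (d : ℕ) → d * p₀ ≡ n → HasOrder s d
  order-of-cofactor d dp₀≡n with cofactor-admissible d dp₀≡n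
  ... | nz , d∣n , fixed = nz , d∣n , fixed , λ d′ nz′ d′∣n fixed′ →
    *-cancelʳ-≤ d′ d p₀ (subst (d′ * p₀ ≤_) (sym dp₀≡n) (admissible-bound d′ (nz′ , d′∣n , fixed′)))

  -- … and an order is admissible and at least the cofactor |s| / p₀.
  cofactor-of-order : (d : ℕ) → HasOrder s d → d * p₀ ≡ n
  cofactor-of-order d (nz , d∣n , fixed , maximal) =
    ≤-antisym (admissible-bound d (nz , d∣n , fixed)) (below-d₀ (cofactor-admissible d₀ d₀p₀≡n))
    where
    open ≤-Reasoning
    p₀∣n : p₀ ∣ n
    p₀∣n = divides-periods n (length-period s)
    d₀ = n / p₀
    d₀p₀≡n : d₀ * p₀ ≡ n
    d₀p₀≡n = m/n*n≡m p₀∣n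
    below-d₀ : Admissible d₀ → n ≤ d * p₀
    below-d₀ (nz₀ , d₀∣n , fixed₀) = begin
      n       ≡⟨ d₀p₀≡n ⟨
      d₀ * p₀ ≤⟨ *-monoˡ-≤ p₀ (maximal d₀ nz₀ d₀∣n fixed₀) ⟩
      d * p₀  ∎

indicator : Bool → ℕ
indicator true  = 1
indicator false = 0

count : (ℕ → Bool) → ℕ → ℕ
count P zero    = 0
count P (suc n) = indicator (P 0) + count (λ i → P (suc i)) n

-- Filtering an enumeration of n points keeps count-many of them (this is how occ is defined).
length-filter-applyUpTo : {A : Set} (P : A → Bool) (f : ℕ → A) (n : ℕ) →
                          length (filterᵇ P (applyUpTo f n)) ≡ count (λ i → P (f i)) n
length-filter-applyUpTo P f zero = refl
length-filter-applyUpTo P f (suc n) with P (f 0)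
... | true  = cong suc (length-filter-applyUpTo P (λ i → f (suc i)) n)
... | false = length-filter-applyUpTo P (λ i → f (suc i)) n

count-cong : (P Q : ℕ → Bool) → (∀ i → P i ≡ Q i) → ∀ n → count P n ≡ count Q n
count-cong P Q P≗Q zero    = refl
count-cong P Q P≗Q (suc n) = cong₂ _+_ (cong indicator (P≗Q 0)) (count-cong _ _ (λ i → P≗Q (suc i)) n)

count-+ : (P : ℕ → Bool) (a b : ℕ) → count P (a + b) ≡ count P a + count (λ i → P (a + i)) b
count-+ P zero    b = refl
count-+ P (suc a) b = trans (cong (indicator (P 0) +_) (count-+ (λ i → P (suc i)) a b))
                            (sym (+-assoc (indicator (P 0)) _ _))

count-periodic : (P : ℕ → Bool) (p : ℕ) → Periodic P p → ∀ c → count P (c * p) ≡ c * count P p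
count-periodic P p per zero    = refl
count-periodic P p per (suc c) = trans (count-+ P p (c * p)) (cong (count P p +_) (begin
    count (λ i → P (p + i)) (c * p) ≡⟨ count-cong _ P (λ i → trans (cong P (+-comm p i)) (per i)) (c * p) ⟩
    count P (c * p)                 ≡⟨ count-periodic P p per c ⟩
    c * count P p                   ∎))
  where open ≡-Reasoning

module _ {q k : ℕ} where

  matches : (s : List (Fin q)) .{{_ : NonZero (length s)}} → Vec (Fin q) k → ℕ → Bool
  matches s x i = ⌊ ≡-decᵛ _≟ᶠ_ (window s i k) x ⌋

  occ-count : (s : List (Fin q)) .{{_ : NonZero (length s)}} (x : Vec (Fin q) k) →
              occ s x ≡ count (matches s x) (length s)
  occ-count s@(_ ∷ _) x = length-filter-applyUpTo (matches s x) (λ i → i) (length s)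

  matches-cong : (s t : List (Fin q)) .{{_ : NonZero (length s)}} .{{_ : NonZero (length t)}} →
                 (∀ i → ext s i ≡ ext t i) → (x : Vec (Fin q) k) → ∀ i → matches s x i ≡ matches t x i
  matches-cong s t s≗t x i = cong (λ w → ⌊ ≡-decᵛ _≟ᶠ_ w x ⌋) (window-ext s t i i (λ j → s≗t (i + j)))

  matches-periodic : (s : List (Fin q)) .{{_ : NonZero (length s)}} (p : ℕ) → Periodic (ext s) p →
                     (x : Vec (Fin q) k) → Periodic (matches s x) p
  matches-periodic s p per x i = cong (λ w → ⌊ ≡-decᵛ _≟ᶠ_ w x ⌋) (window-ext s s (i + p) i shifted)
    where
    shifted : ∀ j → ext s (i + p + j) ≡ ext s (i + j)
    shifted j = trans (cong (ext s) (trans (+-assoc i p j) (trans (cong (i +_) (+-comm p j)) (sym (+-assoc i j p)))))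
                      (per (i + j))

  occ-periodic : (s : List (Fin q)) .{{_ : NonZero (length s)}} (p c : ℕ) → Periodic (ext s) p →
                 length s ≡ c * p → (x : Vec (Fin q) k) → occ s x ≡ c * count (matches s x) p
  occ-periodic s p c per len x = begin
    occ s x                         ≡⟨ occ-count s x ⟩
    count (matches s x) (length s)  ≡⟨ cong (count (matches s x)) len ⟩
    count (matches s x) (c * p)     ≡⟨ count-periodic (matches s x) p (matches-periodic s p per x) c ⟩
    c * count (matches s x) p       ∎
    where open ≡-Reasoning

  occ-scale : (s t : List (Fin q)) .{{_ : NonZero (length s)}} .{{_ : NonZero (length t)}} (c : ℕ) →
              (∀ i → ext s i ≡ ext t i) → length s ≡ c * length t → (x : Vec (Fin q) k) → occ s x ≡ c * occ t x
  occ-scale s t c s≗t len x = begin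
    occ s x                                ≡⟨ occ-periodic s (length t) c per len x ⟩
    c * count (matches s x) (length t)     ≡⟨ cong (c *_) (count-cong _ _ (matches-cong s t s≗t x) (length t)) ⟩
    c * count (matches t x) (length t)     ≡⟨ cong (c *_) (occ-count t x) ⟨
    c * occ t x                            ∎
    where
    open ≡-Reasoning
    per : Periodic (ext s) (length t)
    per = periodic-cong (λ i → sym (s≗t i)) (length-period t)

module _ {q k : ℕ} (y : Vec (Fin q) k) where

  LC-power : (c r : ℕ) (t : List (Fin q)) .{{_ : NonZero (length t)}} →
             LC (suc c * r) q k y (pow (suc c) t) ⇔ LC r q k y t
  LC-power c r t@(x ∷ xs) = mk⇔
    (λ (db , start) → (λ z → *-cancelˡ-≡ _ _ (suc c) (trans (sym (scale z)) (db z))) , trans (sym same-start) start)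
    (λ (db , start) → (λ z → trans (scale z) (cong (suc c *_) (db z))) , trans same-start start)
    where
    s = pow (suc c) t
    s≗t : ∀ i → ext s i ≡ ext t i
    s≗t = ext-pow c x xs
    scale : ∀ z → occ s z ≡ suc c * occ t z
    scale = occ-scale s t (suc c) s≗t (length-pow (suc c) t)
    same-start : window s 0 k ≡ window t 0 k
    same-start = window-ext s t 0 0 s≗t

  -- Forward inclusion: if t ∈ LC_y(r,q,k) has |t| = e·p₀, then t^c has order c·e,
  -- and c·e ∣ c·r since r = e · (number of occurrences of a fixed k-mer in one period).
  order-of-power : Fin q → (c r : ℕ) (t : List (Fin q)) → LC r q k y t →
                   ∃ λ d → d ∣ suc c * r × suc c ∣ d × LCd d (suc c * r) q k y (pow (suc c) t)
  order-of-power letter c r []         (_ , ())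
  order-of-power letter c r t@(a ∷ as) t∈LC@(db , _)
    with fundamental-period (≡-decᵐ _≟ᶠ_) (ext t) (length t) (length-period t)
  ... | p₀ , p₀≢0 , per₀ , divides-periods with divides-periods (length t) (length-period t)
  ...   | divides e |t|≡ep₀ = C * e , *-monoʳ-∣ C e∣r , m∣m*n e , LC-s , order
    where
    instance _ = p₀≢0
    C = suc c
    s = pow C t
    s≗t : ∀ i → ext s i ≡ ext t i
    s≗t = ext-pow c a as
    LC-s : LC (C * r) q k y s
    LC-s = Equivalence.from (LC-power c r t) t∈LC
    x₀ = Vec.replicate k letter
    e∣r : e ∣ r
    e∣r = divides (count (matches t x₀) p₀)
            (trans (sym (db x₀)) (trans (occ-periodic t p₀ e per₀ |t|≡ep₀ x₀) (*-comm e _)))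
    order : HasOrder s (C * e)
    order = Order.order-of-cofactor s (periodic-cong (λ i → sym (s≗t i)) per₀)
              (λ p per → divides-periods p (periodic-cong s≗t per)) (C * e) (begin
      C * e * p₀        ≡⟨ *-assoc C e p₀ ⟩
      C * (e * p₀)      ≡⟨ cong (C *_) |t|≡ep₀ ⟨
      C * length t      ≡⟨ length-pow C t ⟨
      length s          ∎)
      where open ≡-Reasoning

  -- Backward inclusion: if s ∈ LC^{(d)}_y(c·r,q,k) with d = e·c, then e·p₀ is a period and
  -- |s| = c·(e·p₀), so s = t^c for the prefix t of length e·p₀, and t ∈ LC_y(r,q,k).
  root-of-order : (c r d : ℕ) (s : List (Fin q)) → suc c ∣ d → LCd d (suc c * r) q k y s →
                  ∃ λ t → LC r q k y t × s ≡ pow (suc c) t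
  root-of-order c r d []         _                  ((_ , ()) , _)
  root-of-order c r d s@(_ ∷ _) (divides e d≡eC) (s∈LC , order)
    with fundamental-period (≡-decᵐ _≟ᶠ_) (ext s) (length s) (length-period s)
  ... | p₀ , p₀≢0 , per₀ , divides-periods = t , Equivalence.to (LC-power c r t) (subst (LC (C * r) q k y) s≡tᶜ s∈LC) , s≡tᶜ
    where
    instance _ = p₀≢0
    C = suc c
    L = e * p₀
    |s|≡CL : length s ≡ C * L
    |s|≡CL = begin
      length s       ≡⟨ Order.cofactor-of-order s per₀ divides-periods d order ⟨
      d * p₀         ≡⟨ cong (_* p₀) (trans d≡eC (*-comm e C)) ⟩
      C * e * p₀     ≡⟨ *-assoc C e p₀ ⟩
      C * L          ∎
      where open ≡-Reasoning
    instance
      L≢0 : NonZero L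
      L≢0 = m*n≢0⇒n≢0 C {{subst NonZero |s|≡CL it}}
    t = take L s
    s≡tᶜ : s ≡ pow C t
    s≡tᶜ = power-of-prefix s c L (periodic-* (ext s) per₀ e) |s|≡CL
    instance
      t≢0 : NonZero (length t)
      t≢0 = m*n≢0⇒n≢0 C {{subst NonZero (trans (cong length s≡tᶜ) (length-pow C t)) it}}

lemma3 : (m q k : ℕ) → m ≥ 1 → q ≥ 1 → k ≥ 1 → (y : Vec (Fin q) k) →
         (r : ℕ) → .{{_ : NonZero r}} → r ∣ m →
         (s : List (Fin q)) →
         LCpow m r q k y s ⇔ (∃ λ d → d ∣ m × (m / r) ∣ d × LCd d m q k y s)
lemma3 m zero    k _  () _ y r _                      s
lemma3 _ (suc q) k () _  _ y r (divides zero refl)    s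
lemma3 _ (suc q) k _  _  _ y r (divides (suc c) refl) s = mk⇔ forward backward
  where
  C = suc c
  m/r≡C : C * r / r ≡ C
  m/r≡C = m*n/n≡m C r
  forward : LCpow (C * r) r (suc q) k y s → ∃ λ d → d ∣ C * r × (C * r / r) ∣ d × LCd d (C * r) (suc q) k y s
  forward (t , t∈LC , s≡tᶜ) with order-of-power y Fin.zero c r t t∈LC
  ... | d , d∣m , C∣d , tᶜ∈LCd =
    d , d∣m , subst (_∣ d) (sym m/r≡C) C∣d ,
    subst (LCd d (C * r) (suc q) k y) (sym (trans s≡tᶜ (cong (λ e → pow e t) m/r≡C))) tᶜ∈LCd
  backward : (∃ λ d → d ∣ C * r × (C * r / r) ∣ d × LCd d (C * r) (suc q) k y s) → LCpow (C * r) r (suc q) k y s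
  backward (d , _ , m/r∣d , s∈LCd) with root-of-order y c r d s (subst (_∣ d) m/r≡C m/r∣d) s∈LCd
  ... | t , t∈LC , s≡tᶜ = t , t∈LC , trans s≡tᶜ (cong (λ e → pow e t) (sym m/r≡C))
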